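{- Let $p$ be an odd prime, $F$ the finite field of order $p^n$ and $L$ its quadratic extension. Let $k$ be an integer with $0\le k\le p^n$, let $s=1+k(p^n-1)$ and $s'=1+(2-k+p^n)(p^n-1)$. Then the equations $(1-x)^s+x^s-1=0$ and $(1-x)^{s'}+x^{s'}-1=0$ have the same number of solutions $x\in L$. -}

module Defs where

open import Level using (Level; _⊔_) renaming (suc to lsuc)
open import Data.Nat using (ℕ)
open import Data.Fin using (Fin)
open import Data.List using (List; length; filter)
open import Data.List using () renaming (allFin to allFinL)
open import Data.Product using (∃)
open import Relation.Nullary using (¬_)
open import Relation.Binary.Definitions using (Decidable)
open import Relation.Binary.PropositionalEquality using (_≡_)
open import Algebra.Bundles using (CommutativeRing; Semiring)
import Algebra.Definitions.RawSemiring as RawSemiringDefs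

record FiniteField (c ℓ : Level) : Set (lsuc (c ⊔ ℓ)) where
  field
    commutativeRing : CommutativeRing c ℓ
  open CommutativeRing commutativeRing public
  field
    0≉1     : ¬ (0# ≈ 1#)
    inverse : ∀ x → ¬ (x ≈ 0#) → ∃ λ y → (x * y) ≈ 1#
    _≟_     : Decidable _≈_
    size    : ℕ
    enum    : Fin size → Carrier
    enum-injective  : ∀ i j → enum i ≈ enum j → i ≡ j
    enum-surjective : ∀ x → ∃ λ i → enum i ≈ x
  open RawSemiringDefs (Semiring.rawSemiring semiring) public using (_^_)

numberOfZeros : ∀ {c ℓ} (L : FiniteField c ℓ) → (FiniteField.Carrier L → FiniteField.Carrier L) → ℕ
numberOfZeros L f = length (filter (λ i → f (enum i) ≟ 0#) (allFinL size))
  where open FiniteField L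

eqn : ∀ {c ℓ} (L : FiniteField c ℓ) → ℕ → FiniteField.Carrier L → FiniteField.Carrier L
eqn L s x = ((1# - x) ^ s + x ^ s) - 1#
  where open FiniteField L

{-# OPTIONS --safe #-}
-- With q = p ^ n we have |L| = q², so y ^ (q²) = y on L, and F y = y ^ q is an
-- additive involution of L fixing 1.  The exponents satisfy s' ≡ s q modulo
-- q² - 1 and both are positive, so y ^ s' = F (y ^ s) for every y, zero included.
-- Hence (1 - x) ^ s' + x ^ s' = F ((1 - x) ^ s + x ^ s), which is 1 exactly when
-- (1 - x) ^ s + x ^ s is.
module Submission where

open import Defs

open import Algebra.Bundles using (CommutativeMonoid; CommutativeSemiring)
open import Algebra.Definitions using (Congruent₁)
import Algebra.Properties.CommutativeMonoid.Sum
open import Data.Empty using (⊥-elim)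
open import Data.Fin as Fin using (Fin; punchIn)
open import Data.Fin.Permutation using (Permutation; permutation)
open import Data.Fin.Properties using (¬Fin0; toℕ-fromℕ; inject₁ℕ<; punchInᵢ≢i)
open import Data.List using (length; allFin)
open import Data.List.Properties using (filter-≐)
open import Data.Nat as ℕ using (ℕ; zero; suc; s≤s; z≤n)
import Data.Nat.Properties as ℕₚ
open import Data.Nat.Combinatorics using (_C_; nCn≡1; k![n∸k]!∣n!)
open import Data.Nat.Combinatorics.Specification using (nCk≡n!/k![n-k]!)
open import Data.Nat.Divisibility using (_∣_; divides; ∣1⇒≡1; ∣⇒≤; ∣m⇒∣m*n; ∣-refl)
open import Data.Nat.DivMod using (m/n*n≡m)
open import Data.Nat.Primality using (Prime; euclidsLemma; ¬prime[1])
open import Data.Nat.Tactic.RingSolver using (solve-∀)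
open import Data.Product using (_,_; proj₁; proj₂)
open import Data.Sum using (_⊎_; inj₁; inj₂)
open import Function using (_∘_)
open import Relation.Nullary using (¬_; yes; no)
open import Relation.Binary.PropositionalEquality as ≡ using (_≡_; _≢_)

module _ where
  open import Data.Nat using (_+_; _*_; _∸_; _≤_; _<_; _!)
  open import Data.Nat.Properties using (_!*_!≢0)

  prime∤! : ∀ {p} → Prime p → ∀ m → m < p → ¬ p ∣ m !
  prime∤! pp  zero    _   p∣1 = ¬prime[1] (≡.subst Prime (∣1⇒≡1 p∣1) pp)
  prime∤! pp  (suc m) m<p p∣m! with euclidsLemma (suc m) (m !) pp p∣m!
  ... | inj₁ p∣1+m = ℕₚ.<⇒≱ m<p (∣⇒≤ p∣1+m)
  ... | inj₂ p∣m!  = prime∤! pp m (ℕₚ.<-trans (ℕₚ.n<1+n m) m<p) p∣m!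

  nCk*k!*[n∸k]!≡n! : ∀ {n k} → k ≤ n → (n C k) * (k ! * (n ∸ k) !) ≡ n !
  nCk*k!*[n∸k]!≡n! {n} {k} k≤n =
    ≡.trans (≡.cong (_* (k ! * (n ∸ k) !)) (nCk≡n!/k![n-k]! k≤n))
            (m/n*n≡m {{k !* (n ∸ k) !≢0}} (k![n∸k]!∣n! k≤n))

  prime∣pCk : ∀ {p} → Prime p → ∀ {k} → 0 < k → k < p → p ∣ p C k
  prime∣pCk {p@(suc p-1)} pp {k} 0<k k<p
    with euclidsLemma (p C k) (k ! * (p ∸ k) !) pp
           (≡.subst (p ∣_) (≡.sym (nCk*k!*[n∸k]!≡n! (ℕₚ.<⇒≤ k<p))) (∣m⇒∣m*n (p-1 !) ∣-refl))
  ... | inj₁ p∣pCk = p∣pCk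
  ... | inj₂ p∣k!*[p∸k]! with euclidsLemma (k !) ((p ∸ k) !) pp p∣k!*[p∸k]!
  ...   | inj₁ p∣k! = ⊥-elim (prime∤! pp k k<p p∣k!)
  ...   | inj₂ p∣[p∸k]! = ⊥-elim (prime∤! pp (p ∸ k) (ℕₚ.∸-monoʳ-< 0<k (ℕₚ.<⇒≤ k<p)) p∣[p∸k]!)

  -- With q = suc r, so that r + r * suc r = q² - 1: for k = 0, s' = s q + (q² - 1);
  -- for k = suc k', s q = s' + k' (q² - 1).
  twist-exponent-zero : ∀ r → 1 + (3 + r) * r ≡ 1 * (r + r * suc r) + (1 + 0 * r) * suc r
  twist-exponent-zero = solve-∀

  twist-exponent-suc : ∀ {k r} → k ≤ r →
    (1 + suc k * r) * suc r ≡ k * (r + r * suc r) + (1 + ((2 + r) ∸ k) * r)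
  twist-exponent-suc {k} k≤r with d , ≡.refl ← ℕₚ.m≤n⇒∃[o]m+o≡n k≤r =
    ≡.trans (polynomial k d)
            (≡.cong (λ j → k * (r + r * suc r) + (1 + j * r)) (≡.sym 2+r∸k≡2+d))
    where
    r = k + d
    polynomial : ∀ k d → (1 + suc k * (k + d)) * suc (k + d)
                       ≡ k * ((k + d) + (k + d) * suc (k + d)) + (1 + (2 + d) * (k + d))
    polynomial = solve-∀
    2+r∸k≡2+d : (2 + r) ∸ k ≡ 2 + d
    2+r∸k≡2+d = ≡.trans (ℕₚ.+-∸-assoc 2 k≤r) (≡.cong (2 +_) (ℕₚ.m+n∸m≡n k d))

module CommutativeMonoidProperties {a ℓ} (M : CommutativeMonoid a ℓ) where
  open CommutativeMonoid M renaming (_∙_ to _+_; ε to 0#)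
  open import Algebra.Properties.CommutativeMonoid.Sum M using (sum; sum-remove; sum-cong-≋)
  open import Relation.Binary.Reasoning.Setoid setoid

  sum-exchange : ∀ {n} (f g : Fin n → Carrier) (z : Fin n) → (∀ i → i ≢ z → f i ≈ g i) →
                 g z + sum f ≈ f z + sum g
  sum-exchange {suc n} f g z f≈g = begin
    g z + sum f                           ≈⟨ ∙-congˡ (sum-remove f) ⟩
    g z + (f z + sum (f ∘ punchIn z))     ≈⟨ x∙yz≈y∙xz (g z) (f z) _ ⟩
    f z + (g z + sum (f ∘ punchIn z))     ≈⟨ ∙-congˡ (∙-congˡ (sum-cong-≋ (λ j → f≈g _ (punchInᵢ≢i z j)))) ⟩
    f z + (g z + sum (g ∘ punchIn z))     ≈⟨ ∙-congˡ (sum-remove g) ⟨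
    f z + sum g                           ∎
    where open import Algebra.Properties.CommutativeSemigroup commutativeSemigroup using (x∙yz≈y∙xz)

module FreshmansDream {a ℓ} (R : CommutativeSemiring a ℓ) where
  open CommutativeSemiring R
  open import Algebra.Properties.Semiring.Mult semiring using (_×_; ×-homo-1; ×-assoc-*; ×1-homo-*)
  open import Algebra.Properties.Semiring.Exp semiring using (_^_; ^-assocʳ; ^-congˡ)
  open import Algebra.Properties.CommutativeSemiring.Binomial R using (theorem; binomialTerm)
  open import Algebra.Properties.Monoid.Sum +-monoid using (sum; sum-init-last; sum-cong-≋; sum-replicate-zero)
  open import Relation.Binary.Reasoning.Setoid setoid

  ×≈×1* : ∀ m x → m × x ≈ (m × 1#) * x
  ×≈×1* m x = trans (×-congʳ m (sym (*-identityˡ x))) (sym (×-assoc-* m 1# x))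
    where open import Algebra.Properties.Semiring.Mult semiring using (×-congʳ)

  ∣⇒×≈0 : ∀ {p m} → p × 1# ≈ 0# → p ∣ m → ∀ x → m × x ≈ 0#
  ∣⇒×≈0 {p} p×1≈0 (divides d ≡.refl) x = begin
    (d ℕ.* p) × x                  ≈⟨ ×≈×1* (d ℕ.* p) x ⟩
    ((d ℕ.* p) × 1#) * x           ≈⟨ *-congʳ (×1-homo-* d p) ⟩
    ((d × 1#) * (p × 1#)) * x      ≈⟨ *-congʳ (*-congˡ p×1≈0) ⟩
    ((d × 1#) * 0#) * x            ≈⟨ *-congʳ (zeroʳ _) ⟩
    0# * x                         ≈⟨ zeroˡ x ⟩
    0#                             ∎

  binomialTerm-last : ∀ x y n → binomialTerm x y n (Fin.fromℕ n) ≈ x ^ n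
  binomialTerm-last x y n rewrite toℕ-fromℕ n | nCn≡1 n | ℕₚ.n∸n≡0 n =
    trans (×-homo-1 _) (*-identityʳ _)

  ^p-homo-+ : ∀ {p} → Prime p → p × 1# ≈ 0# → ∀ x y → (x + y) ^ p ≈ x ^ p + y ^ p
  ^p-homo-+ {p@(suc p-1)} pp p×1≈0 x y = begin
    (x + y) ^ p                                     ≈⟨ theorem p x y ⟩
    t Fin.zero + sum (t ∘ Fin.suc)                  ≈⟨ +-congˡ (sum-init-last (t ∘ Fin.suc)) ⟩
    t Fin.zero + (sum inner + t (Fin.fromℕ p))      ≈⟨ +-congˡ (+-cong inner≈0 (binomialTerm-last x y p)) ⟩
    t Fin.zero + (0# + x ^ p)                       ≈⟨ +-congˡ (+-identityˡ _) ⟩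
    t Fin.zero + x ^ p                              ≈⟨ +-comm _ _ ⟩
    x ^ p + t Fin.zero                              ≈⟨ +-congˡ (trans (×-homo-1 _) (*-identityˡ _)) ⟩
    x ^ p + y ^ p                                   ∎
    where
    t = binomialTerm x y p
    inner : Fin p-1 → Carrier
    inner j = t (Fin.suc (Fin.inject₁ j))
    inner≈0 : sum inner ≈ 0#
    inner≈0 = trans (sum-cong-≋ (λ j → ∣⇒×≈0 p×1≈0 (prime∣pCk pp (s≤s z≤n) (s≤s (inject₁ℕ< j))) _))
                    (sum-replicate-zero p-1)

  ^p^e-homo-+ : ∀ {p} → Prime p → p × 1# ≈ 0# → ∀ e x y →
                (x + y) ^ (p ℕ.^ e) ≈ x ^ (p ℕ.^ e) + y ^ (p ℕ.^ e)
  ^p^e-homo-+ pp p×1≈0 zero x y = trans (*-identityʳ _) (+-cong (sym (*-identityʳ x)) (sym (*-identityʳ y)))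
  ^p^e-homo-+ {p} pp p×1≈0 (suc e) x y = begin
    (x + y) ^ (p ℕ.* p ℕ.^ e)                    ≈⟨ ^-assocʳ (x + y) p (p ℕ.^ e) ⟨
    ((x + y) ^ p) ^ (p ℕ.^ e)                    ≈⟨ ^-congˡ (p ℕ.^ e) (^p-homo-+ pp p×1≈0 x y) ⟩
    (x ^ p + y ^ p) ^ (p ℕ.^ e)                  ≈⟨ ^p^e-homo-+ pp p×1≈0 e (x ^ p) (y ^ p) ⟩
    (x ^ p) ^ (p ℕ.^ e) + (y ^ p) ^ (p ℕ.^ e)    ≈⟨ +-cong (^-assocʳ x p (p ℕ.^ e)) (^-assocʳ y p (p ℕ.^ e)) ⟩
    x ^ (p ℕ.* p ℕ.^ e) + y ^ (p ℕ.* p ℕ.^ e)    ∎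

module FiniteFieldProperties {c ℓ} (L : FiniteField c ℓ) where
  open FiniteField L
  open import Algebra.Properties.Semiring.Mult semiring using (_×_; ×-congˡ; ×1-homo-*)
  open import Algebra.Properties.Semiring.Exp semiring using (^-congˡ; ^-congʳ; ^-homo-*; ^-assocʳ)
  open import Algebra.Properties.Group +-group using (x∙y⁻¹≈ε⇒x≈y; x≈y⇒x∙y⁻¹≈ε; identityˡ-unique)
  open CommutativeMonoidProperties *-commutativeMonoid using () renaming (sum-exchange to ∏-exchange)
  module Σ = Algebra.Properties.CommutativeMonoid.Sum +-commutativeMonoid
  module Π = Algebra.Properties.CommutativeMonoid.Sum *-commutativeMonoid
  open import Relation.Binary.Reasoning.Setoid setoid

  idx : Carrier → Fin size
  idx x = proj₁ (enum-surjective x)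

  enum-idx : ∀ x → enum (idx x) ≈ x
  enum-idx x = proj₂ (enum-surjective x)

  reindex : (φ ψ : Carrier → Carrier) → Congruent₁ _≈_ φ → Congruent₁ _≈_ ψ →
            (∀ x → φ (ψ x) ≈ x) → (∀ x → ψ (φ x) ≈ x) → Permutation size size
  reindex φ ψ φ-cong ψ-cong φψ ψφ = permutation (idx ∘ φ ∘ enum) (idx ∘ ψ ∘ enum)
      (inverse-of φ ψ φ-cong φψ) (inverse-of ψ φ ψ-cong ψφ)
    where
    inverse-of : ∀ f g → Congruent₁ _≈_ f → (∀ x → f (g x) ≈ x) →
                 ∀ i → idx (f (enum (idx (g (enum i))))) ≡ i
    inverse-of f g f-cong fg i = enum-injective _ _ (begin
      enum (idx (f (enum (idx (g (enum i))))))   ≈⟨ enum-idx _ ⟩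
      f (enum (idx (g (enum i))))                ≈⟨ f-cong (enum-idx _) ⟩
      f (g (enum i))                             ≈⟨ fg _ ⟩
      enum i                                     ∎)

  *-cancelˡ-≉0 : ∀ {a} x y → ¬ a ≈ 0# → a * x ≈ a * y → x ≈ y
  *-cancelˡ-≉0 {a} x y a≉0 ax≈ay with b , ab≈1 ← inverse a a≉0 = begin
    x               ≈⟨ *-identityˡ x ⟨
    1# * x          ≈⟨ *-congʳ ba≈1 ⟨
    (b * a) * x     ≈⟨ *-assoc b a x ⟩
    b * (a * x)     ≈⟨ *-congˡ ax≈ay ⟩
    b * (a * y)     ≈⟨ *-assoc b a y ⟨
    (b * a) * y     ≈⟨ *-congʳ ba≈1 ⟩
    1# * y          ≈⟨ *-identityˡ y ⟩
    y               ∎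
    where ba≈1 = trans (*-comm b a) ab≈1

  x*y≈0⇒x≈0⊎y≈0 : ∀ x y → x * y ≈ 0# → x ≈ 0# ⊎ y ≈ 0#
  x*y≈0⇒x≈0⊎y≈0 x y xy≈0 with x ≟ 0#
  ... | yes x≈0 = inj₁ x≈0
  ... | no x≉0  = inj₂ (*-cancelˡ-≉0 y 0# x≉0 (trans xy≈0 (sym (zeroʳ x))))

  size×x≈0 : ∀ x → size × x ≈ 0#
  size×x≈0 x = identityˡ-unique (size × x) S (sym (begin
    S                                   ≈⟨ Σ.sum-permute enum π ⟩
    Σ.sum (enum ∘ idx ∘ (x +_) ∘ enum)  ≈⟨ Σ.sum-cong-≋ (λ i → enum-idx (x + enum i)) ⟩
    Σ.sum {size} (λ i → x + enum i)     ≈⟨ Σ.∑-distrib-+ (λ _ → x) enum ⟩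
    Σ.sum {size} (λ _ → x) + S          ≈⟨ +-congʳ (Σ.sum-replicate size) ⟩
    size × x + S                        ∎))
    where
    S = Σ.sum enum
    x+[-x+y]≈y : ∀ y → x + (- x + y) ≈ y
    x+[-x+y]≈y y = trans (sym (+-assoc _ _ _)) (trans (+-congʳ (-‿inverseʳ x)) (+-identityˡ y))
    -x+[x+y]≈y : ∀ y → - x + (x + y) ≈ y
    -x+[x+y]≈y y = trans (sym (+-assoc _ _ _)) (trans (+-congʳ (-‿inverseˡ x)) (+-identityˡ y))
    π = reindex (x +_) (- x +_) +-congˡ +-congˡ x+[-x+y]≈y -x+[x+y]≈y

  ^×1≈0⇒×1≈0 : ∀ m e → (m ℕ.^ e) × 1# ≈ 0# → m × 1# ≈ 0#
  ^×1≈0⇒×1≈0 m zero 1+0≈0 = ⊥-elim (0≉1 (sym (trans (sym (+-identityʳ 1#)) 1+0≈0)))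
  ^×1≈0⇒×1≈0 m (suc e) m^[1+e]×1≈0
    with x*y≈0⇒x≈0⊎y≈0 _ _ (trans (sym (×1-homo-* m (m ℕ.^ e))) m^[1+e]×1≈0)
  ... | inj₁ m×1≈0   = m×1≈0
  ... | inj₂ m^e×1≈0 = ^×1≈0⇒×1≈0 m e m^e×1≈0

  characteristic : ∀ {m e} → size ≡ m ℕ.^ e → m × 1# ≈ 0#
  characteristic {m} {e} size≡m^e = ^×1≈0⇒×1≈0 m e (trans (×-congˡ (≡.sym size≡m^e)) (size×x≈0 1#))

  zeroToOne : Carrier → Carrier
  zeroToOne x with x ≟ 0#
  ... | yes _ = 1#
  ... | no _  = x

  zeroToOne-≉0 : ∀ x → ¬ zeroToOne x ≈ 0#
  zeroToOne-≉0 x with x ≟ 0#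
  ... | yes _  = λ 1≈0 → 0≉1 (sym 1≈0)
  ... | no x≉0 = x≉0

  zeroToOne-≈0 : ∀ {x} → x ≈ 0# → zeroToOne x ≈ 1#
  zeroToOne-≈0 {x} x≈0 with x ≟ 0#
  ... | yes _  = refl
  ... | no x≉0 = ⊥-elim (x≉0 x≈0)

  zeroToOne-≉0-id : ∀ {x} → ¬ x ≈ 0# → zeroToOne x ≈ x
  zeroToOne-≉0-id {x} x≉0 with x ≟ 0#
  ... | yes x≈0 = ⊥-elim (x≉0 x≈0)
  ... | no _    = refl

  ∏-≉0 : ∀ {n} (f : Fin n → Carrier) → (∀ i → ¬ f i ≈ 0#) → ¬ Π.sum f ≈ 0#
  ∏-≉0 {zero}  f f≉0 1≈0 = 0≉1 (sym 1≈0)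
  ∏-≉0 {suc n} f f≉0 ∏f≈0 with x*y≈0⇒x≈0⊎y≈0 _ _ ∏f≈0
  ... | inj₁ f0≈0  = f≉0 Fin.zero f0≈0
  ... | inj₂ ∏≈0   = ∏-≉0 (f ∘ Fin.suc) (f≉0 ∘ Fin.suc) ∏≈0

  -- P is the product of the nonzero elements; multiplication by x ≉ 0 permutes
  -- them, so x ^ size * P ≈ x * P, the extra factor x coming from the fixed point 0.
  x^size≈x : ∀ x → x ^ size ≈ x
  x^size≈x x with x ≟ 0#
  ... | yes x≈0 = trans (^-congˡ size x≈0) (trans (0^n≈0 (idx 0#)) (sym x≈0))
    where
    0^n≈0 : ∀ {n} → Fin n → 0# ^ n ≈ 0#
    0^n≈0 {suc n} _ = zeroˡ _
  ... | no x≉0 with x⁻¹ , xx⁻¹≈1 ← inverse x x≉0 = *-cancelˡ-≉0 _ _ P≉0 (begin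
    P * x ^ size                  ≈⟨ *-comm P _ ⟩
    x ^ size * P                  ≈⟨ *-congʳ (Π.sum-replicate size) ⟨
    Π.sum {size} (λ _ → x) * P    ≈⟨ Π.∑-distrib-+ (λ _ → x) (zeroToOne ∘ enum) ⟨
    Π.sum f                       ≈⟨ *-identityˡ _ ⟨
    1# * Π.sum f                  ≈⟨ *-congʳ g[z]≈1 ⟨
    g z * Π.sum f                 ≈⟨ ∏-exchange f g z f≈g ⟩
    f z * Π.sum g                 ≈⟨ *-cong f[z]≈x (sym (Π.sum-permute (zeroToOne ∘ enum) π)) ⟩
    x * P                         ≈⟨ *-comm x P ⟩
    P * x                         ∎)
    where
    P = Π.sum (zeroToOne ∘ enum)
    P≉0 = ∏-≉0 (zeroToOne ∘ enum) (zeroToOne-≉0 ∘ enum)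
    x⁻¹x≈1 = trans (*-comm x⁻¹ x) xx⁻¹≈1
    cancel : ∀ {a b} → a * b ≈ 1# → ∀ y → a * (b * y) ≈ y
    cancel {a} {b} ab≈1 y = trans (sym (*-assoc a b y)) (trans (*-congʳ ab≈1) (*-identityˡ y))
    π = reindex (x *_) (x⁻¹ *_) *-congˡ *-congˡ (cancel xx⁻¹≈1) (cancel x⁻¹x≈1)
    z = idx 0#
    f g : Fin size → Carrier
    f i = x * zeroToOne (enum i)
    g i = zeroToOne (enum (idx (x * enum i)))
    f[z]≈x : f z ≈ x
    f[z]≈x = trans (*-congˡ (zeroToOne-≈0 (enum-idx 0#))) (*-identityʳ x)
    g[z]≈1 : g z ≈ 1#
    g[z]≈1 = zeroToOne-≈0 (trans (enum-idx _) (trans (*-congˡ (enum-idx 0#)) (zeroʳ x)))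
    f≈g : ∀ i → i ≢ z → f i ≈ g i
    f≈g i i≢z = begin
      x * zeroToOne (enum i)            ≈⟨ *-congˡ (zeroToOne-≉0-id enum[i]≉0) ⟩
      x * enum i                        ≈⟨ enum-idx _ ⟨
      enum (idx (x * enum i))           ≈⟨ zeroToOne-≉0-id xe≉0 ⟨
      g i                               ∎
      where
      enum[i]≉0 : ¬ enum i ≈ 0#
      enum[i]≉0 e≈0 = i≢z (enum-injective _ _ (trans e≈0 (sym (enum-idx 0#))))
      xe≉0 : ¬ enum (idx (x * enum i)) ≈ 0#
      xe≉0 e≈0 with x*y≈0⇒x≈0⊎y≈0 _ _ (trans (sym (enum-idx _)) e≈0)
      ... | inj₁ x≈0 = x≉0 x≈0
      ... | inj₂ e≈0′ = enum[i]≉0 e≈0′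

  ^-periodic : ∀ {N} → size ≡ suc N → ∀ t m x → x ^ (t ℕ.* N ℕ.+ suc m) ≈ x ^ suc m
  ^-periodic size≡1+N zero m x = refl
  ^-periodic {N} size≡1+N (suc t) m x = begin
    x ^ ((N ℕ.+ t ℕ.* N) ℕ.+ suc m)    ≈⟨ ^-congʳ x (≡.trans (+-suc _ m) (≡.cong suc (ℕₚ.+-assoc N (t ℕ.* N) m))) ⟩
    x ^ (suc N ℕ.+ (t ℕ.* N ℕ.+ m))    ≈⟨ ^-homo-* x (suc N) _ ⟩
    x ^ suc N * x ^ (t ℕ.* N ℕ.+ m)    ≈⟨ *-congʳ x^[1+N]≈x ⟩
    x ^ suc (t ℕ.* N ℕ.+ m)            ≈⟨ ^-congʳ x (+-suc (t ℕ.* N) m) ⟨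
    x ^ (t ℕ.* N ℕ.+ suc m)            ≈⟨ ^-periodic size≡1+N t m x ⟩
    x ^ suc m                          ∎
    where
    x^[1+N]≈x : x ^ suc N ≈ x
    x^[1+N]≈x = trans (^-congʳ x (≡.sym size≡1+N)) (x^size≈x x)
    open ℕₚ using (+-suc)

  ^-twist : ∀ {q k} → size ≡ q ℕ.* q → k ℕ.≤ q → ∀ y →
            y ^ (1 ℕ.+ ((2 ℕ.+ q) ℕ.∸ k) ℕ.* (q ℕ.∸ 1)) ≈ (y ^ (1 ℕ.+ k ℕ.* (q ℕ.∸ 1))) ^ q
  ^-twist {zero} size≡0 _ _ = ⊥-elim (¬Fin0 (≡.subst Fin size≡0 (idx 0#)))
  ^-twist {suc r} {zero} size≡q*q _ y = begin
    y ^ (1 ℕ.+ (3 ℕ.+ r) ℕ.* r)                     ≈⟨ ^-congʳ y (twist-exponent-zero r) ⟩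
    y ^ (1 ℕ.* N ℕ.+ (1 ℕ.+ 0 ℕ.* r) ℕ.* suc r)     ≈⟨ ^-periodic size≡q*q 1 _ y ⟩
    y ^ ((1 ℕ.+ 0 ℕ.* r) ℕ.* suc r)                 ≈⟨ ^-assocʳ y (1 ℕ.+ 0 ℕ.* r) (suc r) ⟨
    (y ^ (1 ℕ.+ 0 ℕ.* r)) ^ suc r                   ∎
    where N = r ℕ.+ r ℕ.* suc r
  ^-twist {suc r} {suc k} size≡q*q (s≤s k≤r) y = begin
    y ^ s′                                          ≈⟨ ^-periodic size≡q*q k _ y ⟨
    y ^ (k ℕ.* N ℕ.+ s′)                            ≈⟨ ^-congʳ y (twist-exponent-suc k≤r) ⟨
    y ^ (s ℕ.* suc r)                               ≈⟨ ^-assocʳ y s (suc r) ⟨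
    (y ^ s) ^ suc r                                 ∎
    where
    N = r ℕ.+ r ℕ.* suc r
    s = 1 ℕ.+ suc k ℕ.* r
    s′ = 1 ℕ.+ ((2 ℕ.+ r) ℕ.∸ k) ℕ.* r

  numberOfZeros-cong : ∀ {f h} → (∀ x → f x ≈ 0# → h x ≈ 0#) → (∀ x → h x ≈ 0# → f x ≈ 0#) →
                       numberOfZeros L f ≡ numberOfZeros L h
  numberOfZeros-cong {f} {h} f⇒h h⇒f = ≡.cong length
    (filter-≐ (λ i → f (enum i) ≟ 0#) (λ i → h (enum i) ≟ 0#)
              ((λ {i} → f⇒h (enum i)) , (λ {i} → h⇒f (enum i))) (allFin size))

  numberOfZeros-eqn-twist : ∀ s s′ (F : Carrier → Carrier) → Congruent₁ _≈_ F →
    (∀ x → F (F x) ≈ x) → (∀ x y → F (x + y) ≈ F x + F y) → F 1# ≈ 1# →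
    (∀ y → y ^ s′ ≈ F (y ^ s)) → numberOfZeros L (eqn L s) ≡ numberOfZeros L (eqn L s′)
  numberOfZeros-eqn-twist s s′ F F-cong F-involutive F-additive F1≈1 twist =
    numberOfZeros-cong
      (λ x eqn≈0 → x≈y⇒x∙y⁻¹≈ε (begin
        (1# - x) ^ s′ + x ^ s′     ≈⟨ +-cong (twist _) (twist x) ⟩
        F (u x) + F (v x)          ≈⟨ F-additive (u x) (v x) ⟨
        F (u x + v x)              ≈⟨ F-cong (x∙y⁻¹≈ε⇒x≈y _ _ eqn≈0) ⟩
        F 1#                       ≈⟨ F1≈1 ⟩
        1#                         ∎))
      (λ x eqn≈0 → x≈y⇒x∙y⁻¹≈ε (begin
        u x + v x                  ≈⟨ F-involutive _ ⟨
        F (F (u x + v x))          ≈⟨ F-cong (F-additive (u x) (v x)) ⟩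
        F (F (u x) + F (v x))      ≈⟨ F-cong (+-cong (twist _) (twist x)) ⟨
        F ((1# - x) ^ s′ + x ^ s′) ≈⟨ F-cong (x∙y⁻¹≈ε⇒x≈y _ _ eqn≈0) ⟩
        F 1#                       ≈⟨ F1≈1 ⟩
        1#                         ∎))
    where
    u v : Carrier → Carrier
    u x = (1# - x) ^ s
    v x = x ^ s

  1#^n≈1# : ∀ n → 1# ^ n ≈ 1#
  1#^n≈1# zero    = refl
  1#^n≈1# (suc n) = trans (*-identityˡ _) (1#^n≈1# n)

  ^q-involutive : ∀ {q} → size ≡ q ℕ.* q → ∀ x → (x ^ q) ^ q ≈ x
  ^q-involutive {q} size≡q*q x = trans (^-assocʳ x q q) (trans (^-congʳ x (≡.sym size≡q*q)) (x^size≈x x))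

open import Data.Nat using (_+_; _*_; _∸_; _^_; _≤_; _%_)

corollary4p7 : ∀ {c ℓ} (p n : ℕ) → Prime p → p % 2 ≡ 1 → 1 ≤ n
    → (L : FiniteField c ℓ) → FiniteField.size L ≡ (p ^ n) * (p ^ n)
    → (k : ℕ) → k ≤ p ^ n
    → numberOfZeros L (eqn L (1 + k * (p ^ n ∸ 1)))
      ≡ numberOfZeros L (eqn L (1 + ((2 + p ^ n) ∸ k) * (p ^ n ∸ 1)))
corollary4p7 p n p-prime _ _ L size≡q*q k k≤q =
  numberOfZeros-eqn-twist s s′ (λ x → x 𝔽.^ q) (^-congˡ q)
    (^q-involutive {q} size≡q*q) (^p^e-homo-+ p-prime p×1≈0 n) (1#^n≈1# q)
    (^-twist {q} {k} size≡q*q k≤q)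
  where
  module 𝔽 = FiniteField L
  open FiniteFieldProperties L
  open FreshmansDream 𝔽.commutativeSemiring using (^p^e-homo-+)
  open import Algebra.Properties.Semiring.Exp 𝔽.semiring using (^-congˡ)
  q = p ^ n
  s = 1 + k * (q ∸ 1)
  s′ = 1 + ((2 + q) ∸ k) * (q ∸ 1)
  p×1≈0 = characteristic {p} {n + n} (≡.trans size≡q*q (≡.sym (ℕₚ.^-distribˡ-+-* p n n)))
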